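{- Let $A_1,\dots,A_n$ be finite multisets and $A=A_1\cup\cdots\cup A_n$. For every reduced mixing forest $F$ with leaves in $A$, $$\sum_{c\in\mathcal{C}_F}(-1)^{|c|}=(-1)^{w_F}.$$
   Context: Elements of $A$ are regarded as distinguishable, each belonging to a specified $A_i$. A reduced forest with leaves in $A$ is a finite forest of rooted trees with unordered children whose leaves (a one-vertex tree is a single leaf) are labelled bijectively by the elements of $A$, each non-leaf vertex having at least two children. $F$ is mixing if for every vertex all of whose children are leaves, those children are labelled by elements belonging to at least two distinct multisets $A_i\ne A_j$; $w_F$ = (number of vertices) $-$ (number of leaves). A gap-free colouring of $F$ of length $r\ge0$ is a map from vertices to $\{0,\dots,r\}$ using every colour, colouring every leaf $0$, with colours strictly decreasing from a vertex to each of its children; $|c|=r$. It is weakly-mixing if some vertex of colour $1$ has two children labelled by elements of two distinct multisets $A_i\ne A_j$, or if colour $1$ is not used. $\mathcal{C}_F$ is the set of gap-free weakly-mixing colourings of $F$. -}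

module Defs where

open import Data.Nat using (ℕ; zero; suc; _≤_; _<ᵇ_; _≡ᵇ_)
open import Data.Fin using (Fin)
import Data.Fin as Fin
open import Data.Bool using (Bool; true; false; _∧_; _∨_; not; if_then_else_)
open import Data.List using (List; []; _∷_; _++_; [_]; map; concatMap; upTo; length)
open import Data.Bool.ListAction using (all; any)
open import Data.List.Membership.Propositional using (_∈_)
open import Data.List.Relation.Unary.All using (All)
open import Data.Integer using (ℤ; +_; -[1+_]) renaming (_+_ to _+ℤ_)
import Data.Integer as ℤ
open import Data.Product using (Σ; _×_; ∃₂)
open import Data.Unit using (⊤)
open import Relation.Binary.PropositionalEquality using (_≡_; _≢_)
open import Relation.Nullary using (¬_)
open import Relation.Nullary.Decidable using (⌊_⌋)

-- Forests with leaves in A = Fin m.  Each element a : Fin m of A belongs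
-- to the multiset A_(block a), where block : Fin m → Fin n.
-- Children are stored in a list; the order is irrelevant to everything
-- below (all notions are invariant under permuting children).

data Tree (m : ℕ) : Set where
  leaf : Fin m → Tree m
  node : List (Tree m) → Tree m

Forest : ℕ → Set
Forest m = List (Tree m)

module _ {m : ℕ} where

  mutual
    leavesT : Tree m → List (Fin m)
    leavesT (leaf a)  = [ a ]
    leavesT (node ts) = leavesF ts

    leavesF : Forest m → List (Fin m)
    leavesF []       = []
    leavesF (t ∷ ts) = leavesT t ++ leavesF ts

  -- number of non-leaf vertices  ( = w_F = #vertices - #leaves )
  mutual
    internalT : Tree m → ℕ
    internalT (leaf _)  = 0
    internalT (node ts) = suc (internalF ts)

    internalF : Forest m → ℕ
    internalF []       = 0
    internalF (t ∷ ts) = internalT t Data.Nat.+ internalF ts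

  mutual
    ReducedT : Tree m → Set
    ReducedT (leaf _)  = ⊤
    ReducedT (node ts) = (2 ≤ length ts) × ReducedF ts

    ReducedF : Forest m → Set
    ReducedF []       = ⊤
    ReducedF (t ∷ ts) = ReducedT t × ReducedF ts

  IsLeaf : Tree m → Set
  IsLeaf t = Σ (Fin m) (λ a → t ≡ leaf a)

  module _ {n : ℕ} (block : Fin m → Fin n) where

    mutual
      MixingT : Tree m → Set
      MixingT (leaf _)  = ⊤
      MixingT (node ts) =
        (All IsLeaf ts →
           ∃₂ λ a b → (leaf a ∈ ts) × (leaf b ∈ ts) × (block a ≢ block b))
        × MixingF ts

      MixingF : Forest m → Set
      MixingF []       = ⊤
      MixingF (t ∷ ts) = MixingT t × MixingF ts

-- Colourings.  A map from the vertices of F to colours is the same thing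
-- as a decoration of F assigning a colour to each non-leaf vertex
-- (leaves are always coloured 0).

data CTree (m : ℕ) : Set where
  cleaf : Fin m → CTree m
  cnode : ℕ → List (CTree m) → CTree m

CForest : ℕ → Set
CForest m = List (CTree m)

module _ {m : ℕ} where

  colour : CTree m → ℕ
  colour (cleaf _)   = 0
  colour (cnode c _) = c

  mutual
    decorationsT : ℕ → Tree m → List (CTree m)
    decorationsT r (leaf a)  = [ cleaf a ]
    decorationsT r (node ts) =
      concatMap (λ c → map (cnode c) (decorationsF r ts)) (upTo (suc r))

    decorationsF : ℕ → Forest m → List (CForest m)
    decorationsF r []       = [ [] ]
    decorationsF r (t ∷ ts) =
      concatMap (λ d → map (d ∷_) (decorationsF r ts)) (decorationsT r t)

  mutual
    coloursT : CTree m → List ℕ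
    coloursT (cleaf _)    = [ 0 ]
    coloursT (cnode c ts) = c ∷ coloursF ts

    coloursF : CForest m → List ℕ
    coloursF []       = []
    coloursF (t ∷ ts) = coloursT t ++ coloursF ts

  mutual
    decreasingT : CTree m → Bool
    decreasingT (cleaf _)    = true
    decreasingT (cnode c ts) = all (λ t → colour t <ᵇ c) ts ∧ decreasingF ts

    decreasingF : CForest m → Bool
    decreasingF []       = true
    decreasingF (t ∷ ts) = decreasingT t ∧ decreasingF ts

  mutual
    colour1ChildrenT : CTree m → List (CForest m)
    colour1ChildrenT (cleaf _)    = []
    colour1ChildrenT (cnode c ts) =
      (if c ≡ᵇ 1 then [ ts ] else []) ++ colour1ChildrenF ts

    colour1ChildrenF : CForest m → List (CForest m)
    colour1ChildrenF []       = []
    colour1ChildrenF (t ∷ ts) = colour1ChildrenT t ++ colour1ChildrenF ts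

  leafLabels : CForest m → List (Fin m)
  leafLabels []              = []
  leafLabels (cleaf a ∷ ts)  = a ∷ leafLabels ts
  leafLabels (cnode _ _ ∷ ts) = leafLabels ts

  elemᵇ : ℕ → List ℕ → Bool
  elemᵇ j xs = any (λ x → j ≡ᵇ x) xs

  module _ {n : ℕ} (block : Fin m → Fin n) where

    mixedChildren : CForest m → Bool
    mixedChildren ts =
      any (λ a → any (λ b → not ⌊ block a Fin.≟ block b ⌋) (leafLabels ts))
          (leafLabels ts)

    isColouring : ℕ → CForest m → Bool
    isColouring r G =
      decreasingF G
      ∧ all (λ j → elemᵇ j (coloursF G)) (upTo (suc r))
      ∧ (any (mixedChildren) (colour1ChildrenF G)
         ∨ not (elemᵇ 1 (coloursF G)))

sign : ℕ → ℤ
sign k = (ℤ.- (+ 1)) ℤ.^ k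

sumℤ : List ℤ → ℤ
sumℤ []       = + 0
sumℤ (x ∷ xs) = x +ℤ sumℤ xs

-- A gap-free colouring of length r uses each of
-- the colours 1,…,r on some non-leaf vertex, so r ≤ internalF F; hence
-- summing over r = 0,…,internalF F covers all of C_F.
colouringSum : {m n : ℕ} → (Fin m → Fin n) → Forest m → ℤ
colouringSum block F =
  sumℤ (map (λ r → sumℤ (map (λ G → if isColouring block r G then sign r else + 0)
                             (decorationsF r F)))
            (upTo (suc (internalF F))))

module Submission where

-- In a reduced forest every internal vertex has a child.  Hence a decreasing
-- colouring uses colour 0 (on the leaves), every vertex of colour 1 is a cherry
-- (all its children are leaves), and mixing makes the weak-mixing condition
-- automatic.  So the colourings of length r are the decreasing decorations with
-- colours 0,…,r using every colour, and inclusion–exclusion over the sets of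
-- admissible colours expresses their number gapFreeCount r F through counts of
-- valid decorations.  These counts factor over the trees and over the colour of
-- a root, which yields  gapFreeCount (r+1) F = Σ gapFreeCount r F′  over the
-- proper collapses F′ of F (replace a nonempty set of cherries, the vertices of
-- colour 1, by leaves).  With gapFreeCount 0 F = [w_F = 0] and the cancellation
-- Σ_{all collapses F′} (-1)^(w_F′) = [w_F = 0], induction on w_F gives
-- Σ_r (-1)^r gapFreeCount r F = (-1)^(w_F), which is the lemma.

open import Defs
open import Data.Nat using (ℕ; zero; suc; pred; _≤_; _<_; _≡ᵇ_; _<ᵇ_; s≤s; z≤n) renaming (_+_ to _+ℕ_)
open import Data.Nat.Properties using (≤-refl; ≤-pred; ≤-trans; <⇒≤; +-monoʳ-<; +-mono-<-≤; n≤0⇒n≡0)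
open import Data.Integer using (ℤ; 0ℤ; 1ℤ; -1ℤ; _-_; _+_; _*_)
open import Data.Integer.Properties
  using (+-identityˡ; +-identityʳ; +-assoc; +-inverseʳ; *-zeroˡ; *-zeroʳ; *-identityˡ; *-identityʳ;
         *-distribˡ-+; *-distribʳ-+; *-assoc; ^-distribˡ-+-*)
open import Data.Integer.Tactic.RingSolver using (solve-∀)
open import Data.Bool using (Bool; true; false; _∧_; _∨_; not; if_then_else_)
open import Data.Bool.Properties using (∧-assoc; ∧-identityʳ; ∧-zeroʳ; ∨-assoc; ∨-zeroʳ)
open import Data.Bool.Solver using (module ∨-∧-Solver)
open import Data.Bool.ListAction using (all; any)
open import Data.Fin using (Fin)
import Data.Fin as Fin
open import Data.Maybe using (Maybe; nothing; just)
import Data.Maybe as Maybe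
open import Data.List using (List; []; _∷_; _++_; map; concatMap; applyUpTo; upTo; allFin)
open import Data.List.Relation.Unary.All as All using (All; []; _∷_)
open import Data.List.Relation.Unary.All.Properties using (map⁺; ++⁺; concat⁺)
open import Data.List.Relation.Unary.Any using (here; there)
open import Data.List.Membership.Propositional using (_∈_)
open import Data.List.Membership.Propositional.Properties using (∈-allFin; ∈-++⁻)
open import Data.List.Relation.Binary.Permutation.Propositional using (_↭_; ↭-sym)
open import Data.List.Relation.Binary.Permutation.Propositional.Properties using (∈-resp-↭)
open import Data.Unit using (⊤; tt)
open import Data.Empty using (⊥; ⊥-elim)
open import Data.Product using (_×_; _,_; proj₁; proj₂; ∃; ∃₂)
open import Data.Sum using (_⊎_; inj₁; inj₂)
open import Relation.Nullary using (yes; no)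
open import Relation.Nullary.Decidable using (⌊_⌋)
open import Relation.Binary.PropositionalEquality

∑ : {A : Set} → (A → ℤ) → List A → ℤ
∑ f xs = sumℤ (map f xs)

∑-cong : {A : Set} {f g : A → ℤ} {xs : List A} → All (λ x → f x ≡ g x) xs → ∑ f xs ≡ ∑ g xs
∑-cong []       = refl
∑-cong (e ∷ es) = cong₂ _+_ e (∑-cong es)

∑-++ : {A : Set} (f : A → ℤ) (xs ys : List A) → ∑ f (xs ++ ys) ≡ ∑ f xs + ∑ f ys
∑-++ f []       ys = sym (+-identityˡ _)
∑-++ f (x ∷ xs) ys = trans (cong (f x +_) (∑-++ f xs ys)) (sym (+-assoc (f x) _ _))

∑-map : {A B : Set} (f : B → ℤ) (g : A → B) (xs : List A) → ∑ f (map g xs) ≡ ∑ (λ x → f (g x)) xs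
∑-map f g []       = refl
∑-map f g (x ∷ xs) = cong (f (g x) +_) (∑-map f g xs)

∑-concatMap : {A B : Set} (f : B → ℤ) (g : A → List B) (xs : List A) →
              ∑ f (concatMap g xs) ≡ ∑ (λ x → ∑ f (g x)) xs
∑-concatMap f g []       = refl
∑-concatMap f g (x ∷ xs) = trans (∑-++ f (g x) (concatMap g xs)) (cong (∑ f (g x) +_) (∑-concatMap f g xs))

∑-zero : {A : Set} (xs : List A) → ∑ (λ _ → 0ℤ) xs ≡ 0ℤ
∑-zero []       = refl
∑-zero (x ∷ xs) = cong (0ℤ +_) (∑-zero xs)

∑-scaleˡ : {A : Set} (k : ℤ) (f : A → ℤ) (xs : List A) → ∑ (λ x → k * f x) xs ≡ k * ∑ f xs
∑-scaleˡ k f []       = sym (*-zeroʳ k)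
∑-scaleˡ k f (x ∷ xs) = trans (cong (k * f x +_) (∑-scaleˡ k f xs)) (sym (*-distribˡ-+ k (f x) _))

∑-scaleʳ : {A : Set} (f : A → ℤ) (k : ℤ) (xs : List A) → ∑ (λ x → f x * k) xs ≡ ∑ f xs * k
∑-scaleʳ f k []       = sym (*-zeroˡ k)
∑-scaleʳ f k (x ∷ xs) = trans (cong (f x * k +_) (∑-scaleʳ f k xs)) (sym (*-distribʳ-+ k (f x) _))

∑-+ : {A : Set} (f g : A → ℤ) (xs : List A) → ∑ (λ x → f x + g x) xs ≡ ∑ f xs + ∑ g xs
∑-+ f g []       = refl
∑-+ f g (x ∷ xs) = trans (cong (f x + g x +_) (∑-+ f g xs)) (interchange (f x) (g x) (∑ f xs) (∑ g xs))
  where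
  interchange : ∀ a b c d → (a + b) + (c + d) ≡ (a + c) + (b + d)
  interchange = solve-∀

consAll : {A : Set} → List A → List (List A) → List (List A)
consAll xs yss = concatMap (λ x → map (x ∷_) yss) xs

∑-consAll : {A : Set} (F : List A → ℤ) (g : A → ℤ) (h : List A → ℤ) →
            (∀ x y → F (x ∷ y) ≡ g x * h y) →
            ∀ xs yss → ∑ F (consAll xs yss) ≡ ∑ g xs * ∑ h yss
∑-consAll F g h split xs yss = begin
  ∑ F (consAll xs yss)                      ≡⟨ ∑-concatMap F (λ x → map (x ∷_) yss) xs ⟩
  ∑ (λ x → ∑ F (map (x ∷_) yss)) xs         ≡⟨ ∑-cong (All.universal row xs) ⟩
  ∑ (λ x → g x * ∑ h yss) xs                ≡⟨ ∑-scaleʳ g (∑ h yss) xs ⟩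
  ∑ g xs * ∑ h yss                          ∎
  where
  open ≡-Reasoning
  row : ∀ x → ∑ F (map (x ∷_) yss) ≡ g x * ∑ h yss
  row x = trans (∑-map F (x ∷_) yss)
                (trans (∑-cong (All.universal (split x) yss)) (∑-scaleˡ (g x) h yss))

sumBelow : ℕ → (ℕ → ℤ) → ℤ
sumBelow zero    h = 0ℤ
sumBelow (suc n) h = h 0 + sumBelow n (λ k → h (suc k))

∑-applyUpTo : (f : ℕ → ℤ) (g : ℕ → ℕ) (n : ℕ) → ∑ f (applyUpTo g n) ≡ sumBelow n (λ k → f (g k))
∑-applyUpTo f g zero    = refl
∑-applyUpTo f g (suc n) = cong (f (g 0) +_) (∑-applyUpTo f (λ k → g (suc k)) n)

sumBelow-cong : ∀ n {f g : ℕ → ℤ} → (∀ k → f k ≡ g k) → sumBelow n f ≡ sumBelow n g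
sumBelow-cong zero    e = refl
sumBelow-cong (suc n) e = cong₂ _+_ (e 0) (sumBelow-cong n (λ k → e (suc k)))

sumBelow-zero : ∀ n → sumBelow n (λ _ → 0ℤ) ≡ 0ℤ
sumBelow-zero zero    = refl
sumBelow-zero (suc n) = cong (0ℤ +_) (sumBelow-zero n)

sumBelow-scale : ∀ n (k : ℤ) (f : ℕ → ℤ) → sumBelow n (λ i → k * f i) ≡ k * sumBelow n f
sumBelow-scale zero    k f = sym (*-zeroʳ k)
sumBelow-scale (suc n) k f =
  trans (cong (k * f 0 +_) (sumBelow-scale n k (λ i → f (suc i)))) (sym (*-distribˡ-+ k (f 0) _))

sumBelow-∑ : {A : Set} (n : ℕ) (f : A → ℕ → ℤ) (xs : List A) →
             sumBelow n (λ k → ∑ (λ x → f x k) xs) ≡ ∑ (λ x → sumBelow n (f x)) xs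
sumBelow-∑ zero    f xs = sym (∑-zero xs)
sumBelow-∑ (suc n) f xs =
  trans (cong (∑ (λ x → f x 0) xs +_) (sumBelow-∑ n (λ x k → f x (suc k)) xs))
        (sym (∑-+ (λ x → f x 0) (λ x → sumBelow n (λ k → f x (suc k))) xs))

-- Inclusion–exclusion over the colours 1,…,r, phrased with an alternating
-- sum over the choices of admissible colours.

⟦_⟧ : Bool → ℤ
⟦ true ⟧  = 1ℤ
⟦ false ⟧ = 0ℤ

⟦∧⟧ : ∀ a b → ⟦ a ∧ b ⟧ ≡ ⟦ a ⟧ * ⟦ b ⟧
⟦∧⟧ true  b = sym (*-identityˡ ⟦ b ⟧)
⟦∧⟧ false b = sym (*-zeroˡ ⟦ b ⟧)

-- A choice ok of admissible colours: colour 0 is always admissible and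
-- colour suc k is admissible iff ok k.
admissible : (ℕ → Bool) → ℕ → Bool
admissible ok zero    = true
admissible ok (suc k) = ok k

_◂_ : Bool → (ℕ → Bool) → ℕ → Bool
(b ◂ ok) zero    = b
(b ◂ ok) (suc k) = ok k

-- the alternating sum  Σ_{ok ∈ Bool^r} (-1)^(number of forbidden colours) h ok
-- over all choices for the colours 1,…,r (colours above r stay admissible)
altSum : ℕ → ((ℕ → Bool) → ℤ) → ℤ
altSum zero    h = h (λ _ → true)
altSum (suc r) h = altSum r (λ ok → h (true ◂ ok)) - altSum r (λ ok → h (false ◂ ok))

altSum-cong : ∀ r {h h′ : (ℕ → Bool) → ℤ} → (∀ ok → h ok ≡ h′ ok) → altSum r h ≡ altSum r h′
altSum-cong zero    e = e _
altSum-cong (suc r) e = cong₂ _-_ (altSum-cong r (λ ok → e _)) (altSum-cong r (λ ok → e _))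

altSum-zero : ∀ r → altSum r (λ _ → 0ℤ) ≡ 0ℤ
altSum-zero zero    = refl
altSum-zero (suc r) = cong₂ _-_ (altSum-zero r) (altSum-zero r)

altSum-scale : ∀ r (k : ℤ) (h : (ℕ → Bool) → ℤ) → altSum r (λ ok → k * h ok) ≡ k * altSum r h
altSum-scale zero    k h = refl
altSum-scale (suc r) k h =
  trans (cong₂ _-_ (altSum-scale r k (λ ok → h (true ◂ ok))) (altSum-scale r k (λ ok → h (false ◂ ok))))
        (factor k _ _)
  where
  factor : ∀ k a b → k * a - k * b ≡ k * (a - b)
  factor = solve-∀

altSum-+ : ∀ r (f g : (ℕ → Bool) → ℤ) → altSum r (λ ok → f ok + g ok) ≡ altSum r f + altSum r g
altSum-+ zero    f g = refl
altSum-+ (suc r) f g =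
  trans (cong₂ _-_ (altSum-+ r (λ ok → f (true ◂ ok)) (λ ok → g (true ◂ ok)))
                   (altSum-+ r (λ ok → f (false ◂ ok)) (λ ok → g (false ◂ ok))))
        (regroup (altSum r (λ ok → f (true ◂ ok))) (altSum r (λ ok → g (true ◂ ok)))
                 (altSum r (λ ok → f (false ◂ ok))) (altSum r (λ ok → g (false ◂ ok))))
  where
  regroup : ∀ a b c d → (a + b) - (c + d) ≡ (a - c) + (b - d)
  regroup = solve-∀

altSum-∑ : {A : Set} (r : ℕ) (h : A → (ℕ → Bool) → ℤ) (xs : List A) →
           altSum r (λ ok → ∑ (λ x → h x ok) xs) ≡ ∑ (λ x → altSum r (h x)) xs
altSum-∑ r h []       = altSum-zero r
altSum-∑ r h (x ∷ xs) =
  trans (altSum-+ r (h x) (λ ok → ∑ (λ y → h y ok) xs)) (cong (altSum r (h x) +_) (altSum-∑ r h xs))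

-- colour j occurs in cs (this is Defs.elemᵇ, which carries an unused
-- implicit parameter)
occurs : ℕ → List ℕ → Bool
occurs j cs = any (λ x → j ≡ᵇ x) cs

everyBelow : ℕ → (ℕ → Bool) → Bool
everyBelow zero    p = true
everyBelow (suc r) p = p 0 ∧ everyBelow r (λ k → p (suc k))

everyBelow-cong : ∀ r {p q : ℕ → Bool} → (∀ k → p k ≡ q k) → everyBelow r p ≡ everyBelow r q
everyBelow-cong zero    e = refl
everyBelow-cong (suc r) e = cong₂ _∧_ (e 0) (everyBelow-cong r (λ k → e (suc k)))

all-applyUpTo : ∀ (p : ℕ → Bool) f r → all p (applyUpTo f r) ≡ everyBelow r (λ k → p (f k))
all-applyUpTo p f zero    = refl
all-applyUpTo p f (suc r) = cong (p (f 0) ∧_) (all-applyUpTo p (λ k → f (suc k)) r)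

admissible-◂ : ∀ b ok (cs : List ℕ) →
  all (admissible (b ◂ ok)) cs ≡ (b ∨ not (occurs 1 cs)) ∧ all (admissible ok) (map pred cs)
admissible-◂ true  ok []                 = refl
admissible-◂ false ok []                 = refl
admissible-◂ b     ok (zero ∷ cs)        = admissible-◂ b ok cs
admissible-◂ b     ok (suc zero ∷ cs)    =
  trans (cong (b ∧_) (admissible-◂ b ok cs)) (absorb b _ _)
  where
  absorb : ∀ b y z → b ∧ ((b ∨ y) ∧ z) ≡ (b ∨ false) ∧ z
  absorb true  y z = refl
  absorb false y z = refl
admissible-◂ b     ok (suc (suc k) ∷ cs) =
  trans (cong (ok k ∧_) (admissible-◂ b ok cs))
        (solve 3 (λ x y z → x :* (y :* z) := y :* (x :* z)) refl
                 (ok k) (b ∨ not (occurs 1 cs)) (all (admissible ok) (map pred cs)))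
  where open ∨-∧-Solver

occurs-pred : ∀ k (cs : List ℕ) → occurs (suc (suc k)) cs ≡ occurs (suc k) (map pred cs)
occurs-pred k []           = refl
occurs-pred k (zero ∷ cs)  = occurs-pred k cs
occurs-pred k (suc c ∷ cs) = cong ((suc k ≡ᵇ c) ∨_) (occurs-pred k cs)

all-admissible-true : ∀ (cs : List ℕ) → all (admissible (λ _ → true)) cs ≡ true
all-admissible-true []           = refl
all-admissible-true (zero ∷ cs)  = all-admissible-true cs
all-admissible-true (suc c ∷ cs) = all-admissible-true cs

inclusion–exclusion : ∀ r (cs : List ℕ) →
  altSum r (λ ok → ⟦ all (admissible ok) cs ⟧) ≡ ⟦ everyBelow r (λ k → occurs (suc k) cs) ⟧
inclusion–exclusion zero    cs = cong ⟦_⟧ (all-admissible-true cs)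
inclusion–exclusion (suc r) cs = begin
    altSum r (λ ok → ⟦ all (admissible (true ◂ ok)) cs ⟧) - altSum r (λ ok → ⟦ all (admissible (false ◂ ok)) cs ⟧)
  ≡⟨ cong₂ _-_ (altSum-cong r (λ ok → cong ⟦_⟧ (admissible-◂ true ok cs)))
               (altSum-cong r (λ ok → cong ⟦_⟧ (admissible-◂ false ok cs))) ⟩
    altSum r (λ ok → ⟦ all (admissible ok) cs′ ⟧) - altSum r (λ ok → ⟦ not e ∧ all (admissible ok) cs′ ⟧)
  ≡⟨ difference e ⟩
    ⟦ e ⟧ * altSum r (λ ok → ⟦ all (admissible ok) cs′ ⟧)
  ≡⟨ cong (⟦ e ⟧ *_) (inclusion–exclusion r cs′) ⟩
    ⟦ e ⟧ * ⟦ everyBelow r (λ k → occurs (suc k) cs′) ⟧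
  ≡⟨ sym (⟦∧⟧ e _) ⟩
    ⟦ e ∧ everyBelow r (λ k → occurs (suc k) cs′) ⟧
  ≡⟨ cong (λ z → ⟦ e ∧ z ⟧) (everyBelow-cong r (λ k → sym (occurs-pred k cs))) ⟩
    ⟦ e ∧ everyBelow r (λ k → occurs (suc (suc k)) cs) ⟧
  ∎
  where
  open ≡-Reasoning
  e : Bool
  e = occurs 1 cs
  cs′ : List ℕ
  cs′ = map pred cs
  X : (ℕ → Bool) → Bool
  X ok = all (admissible ok) cs′
  -- if colour 1 is used, only the term with colour 1 admissible survives
  difference : ∀ e → altSum r (λ ok → ⟦ X ok ⟧) - altSum r (λ ok → ⟦ not e ∧ X ok ⟧)
                     ≡ ⟦ e ⟧ * altSum r (λ ok → ⟦ X ok ⟧)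
  difference true  = trans (cong (altSum r (λ ok → ⟦ X ok ⟧) -_) (altSum-zero r))
                           (trans (+-identityʳ _) (sym (*-identityˡ _)))
  difference false = trans (+-inverseʳ (altSum r (λ ok → ⟦ X ok ⟧)))
                           (sym (*-zeroˡ (altSum r (λ ok → ⟦ X ok ⟧))))

below : Maybe ℕ → ℕ → Bool
below nothing  c = true
below (just b) c = c <ᵇ b

-- the bound for the children of a vertex whose colour was raised by one
raise : Maybe ℕ → Maybe ℕ
raise = Maybe.map suc

below-raise-zero : ∀ B → below (raise B) 0 ≡ true
below-raise-zero nothing  = refl
below-raise-zero (just b) = refl

below-raise-suc : ∀ B k → below (raise B) (suc k) ≡ below B k
below-raise-suc nothing  k = refl
below-raise-suc (just b) k = refl

all-++ : {A : Set} (p : A → Bool) (xs ys : List A) → all p (xs ++ ys) ≡ all p xs ∧ all p ys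
all-++ p []       ys = refl
all-++ p (x ∷ xs) ys = trans (cong (p x ∧_) (all-++ p xs ys)) (sym (∧-assoc (p x) _ _))

⟦+≡ᵇ0⟧ : ∀ a b → ⟦ (a +ℕ b) ≡ᵇ 0 ⟧ ≡ ⟦ a ≡ᵇ 0 ⟧ * ⟦ b ≡ᵇ 0 ⟧
⟦+≡ᵇ0⟧ zero    b = sym (*-identityˡ ⟦ b ≡ᵇ 0 ⟧)
⟦+≡ᵇ0⟧ (suc a) b = sym (*-zeroˡ ⟦ b ≡ᵇ 0 ⟧)

module _ {m : ℕ} where

  mutual
    validT : (ℕ → Bool) → Maybe ℕ → CTree m → Bool
    validT ok B (cleaf a)    = below B 0
    validT ok B (cnode c ds) = below B c ∧ (admissible ok c ∧ validF ok (just c) ds)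

    validF : (ℕ → Bool) → Maybe ℕ → CForest m → Bool
    validF ok B []       = true
    validF ok B (d ∷ ds) = validT ok B d ∧ validF ok B ds

  mutual
    validT-spec : ∀ ok B (d : CTree m) →
      validT ok B d ≡ below B (colour d) ∧ (decreasingT d ∧ all (admissible ok) (coloursT d))
    validT-spec ok B (cleaf a)    = sym (∧-identityʳ (below B 0))
    validT-spec ok B (cnode c ds) =
      trans (cong (λ v → below B c ∧ (admissible ok c ∧ v)) (validF-spec ok (just c) ds))
            (solve 5 (λ b a x y z → b :* (a :* (x :* (y :* z))) := b :* ((x :* y) :* (a :* z))) refl
                   (below B c) (admissible ok c) (all (λ t → colour t <ᵇ c) ds) (decreasingF ds)
                   (all (admissible ok) (coloursF ds)))
      where open ∨-∧-Solver

    validF-spec : ∀ ok B (ds : CForest m) →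
      validF ok B ds ≡ all (λ t → below B (colour t)) ds ∧ (decreasingF ds ∧ all (admissible ok) (coloursF ds))
    validF-spec ok B []       = refl
    validF-spec ok B (d ∷ ds) =
      trans (cong₂ _∧_ (validT-spec ok B d) (validF-spec ok B ds))
            (trans (solve 6 (λ a b c d e f → (a :* (c :* e)) :* (b :* (d :* f))
                                            := (a :* b) :* ((c :* d) :* (e :* f))) refl
                          (below B (colour d)) (all (λ t → below B (colour t)) ds) (decreasingT d)
                          (decreasingF ds) (all (admissible ok) (coloursT d)) (all (admissible ok) (coloursF ds)))
                   (cong (λ v → (below B (colour d) ∧ all (λ t → below B (colour t)) ds)
                                      ∧ ((decreasingT d ∧ decreasingF ds) ∧ v))
                         (sym (all-++ (admissible ok) (coloursT d) (coloursF ds)))))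
      where open ∨-∧-Solver

  all-unbounded : (ds : CForest m) → all (λ t → below nothing (colour t)) ds ≡ true
  all-unbounded []       = refl
  all-unbounded (d ∷ ds) = all-unbounded ds

  validF-unbounded : ∀ ok (G : CForest m) → validF ok nothing G ≡ decreasingF G ∧ all (admissible ok) (coloursF G)
  validF-unbounded ok G = trans (validF-spec ok nothing G)
                               (cong (_∧ (decreasingF G ∧ all (admissible ok) (coloursF G))) (all-unbounded G))

  countT : ℕ → (ℕ → Bool) → Maybe ℕ → Tree m → ℤ
  countT r ok B t = ∑ (λ d → ⟦ validT ok B d ⟧) (decorationsT r t)

  countF : ℕ → (ℕ → Bool) → Maybe ℕ → Forest m → ℤ
  countF r ok B ts = ∑ (λ G → ⟦ validF ok B G ⟧) (decorationsF r ts)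

  countF-cons : ∀ r ok B t ts → countF r ok B (t ∷ ts) ≡ countT r ok B t * countF r ok B ts
  countF-cons r ok B t ts =
    ∑-consAll (λ G → ⟦ validF ok B G ⟧) (λ d → ⟦ validT ok B d ⟧) (λ G → ⟦ validF ok B G ⟧)
              (λ d G → ⟦∧⟧ (validT ok B d) (validF ok B G)) (decorationsT r t) (decorationsF r ts)

  countT-node : ∀ r ok B ts →
    countT r ok B (node ts) ≡ sumBelow (suc r) (λ c → ⟦ below B c ∧ admissible ok c ⟧ * countF r ok (just c) ts)
  countT-node r ok B ts = begin
      ∑ weight (concatMap (λ c → map (cnode c) (decorationsF r ts)) (upTo (suc r)))
    ≡⟨ ∑-concatMap weight (λ c → map (cnode c) (decorationsF r ts)) (upTo (suc r)) ⟩
      ∑ (λ c → ∑ weight (map (cnode c) (decorationsF r ts))) (upTo (suc r))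
    ≡⟨ ∑-applyUpTo (λ c → ∑ weight (map (cnode c) (decorationsF r ts))) (λ c → c) (suc r) ⟩
      sumBelow (suc r) (λ c → ∑ weight (map (cnode c) (decorationsF r ts)))
    ≡⟨ sumBelow-cong (suc r) colourClass ⟩
      sumBelow (suc r) (λ c → ⟦ below B c ∧ admissible ok c ⟧ * countF r ok (just c) ts)
    ∎
    where
    open ≡-Reasoning
    weight : CTree m → ℤ
    weight d = ⟦ validT ok B d ⟧
    colourClass : ∀ c → ∑ weight (map (cnode c) (decorationsF r ts))
                        ≡ ⟦ below B c ∧ admissible ok c ⟧ * countF r ok (just c) ts
    colourClass c =
      trans (∑-map weight (cnode c) (decorationsF r ts))
            (trans (∑-cong (All.universal
                      (λ G → trans (cong ⟦_⟧ (sym (∧-assoc (below B c) (admissible ok c) (validF ok (just c) G))))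
                                   (⟦∧⟧ (below B c ∧ admissible ok c) (validF ok (just c) G)))
                      (decorationsF r ts)))
                   (∑-scaleˡ ⟦ below B c ∧ admissible ok c ⟧ (λ G → ⟦ validF ok (just c) G ⟧) (decorationsF r ts)))

  mutual
    HasChildrenT : Tree m → Set
    HasChildrenT (leaf _)        = ⊤
    HasChildrenT (node [])       = ⊥
    HasChildrenT (node (t ∷ ts)) = HasChildrenT t × HasChildrenF ts

    HasChildrenF : Forest m → Set
    HasChildrenF []       = ⊤
    HasChildrenF (t ∷ ts) = HasChildrenT t × HasChildrenF ts

  hasChildren-children : ∀ (ts : Forest m) → HasChildrenT (node ts) → HasChildrenF ts
  hasChildren-children []       ()
  hasChildren-children (t ∷ ts) hc = hc

  -- a root cannot have colour below 0, so only the empty forest has decorations bounded by 0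
  countT-below0 : ∀ r ok t → countT r ok (just 0) t ≡ 0ℤ
  countT-below0 r ok (leaf a)  = refl
  countT-below0 r ok (node ts) =
    trans (countT-node r ok (just 0) ts)
          (trans (sumBelow-cong (suc r) (λ c → *-zeroˡ (countF r ok (just c) ts))) (sumBelow-zero (suc r)))

  countF-below0 : ∀ r ok t ts → countF r ok (just 0) (t ∷ ts) ≡ 0ℤ
  countF-below0 r ok t ts =
    trans (countF-cons r ok (just 0) t ts)
          (trans (cong (_* countF r ok (just 0) ts) (countT-below0 r ok t)) (*-zeroˡ (countF r ok (just 0) ts)))

  -- a vertex with a child cannot take colour 0, so only the colours suc k, k < r, contribute
  countT-node⁺ : ∀ r ok B ts → HasChildrenT (node ts) →
    countT r ok B (node ts) ≡ sumBelow r (λ k → ⟦ below B (suc k) ∧ ok k ⟧ * countF r ok (just (suc k)) ts)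
  countT-node⁺ r ok B []       ()
  countT-node⁺ r ok B (t ∷ ts) _  =
    trans (countT-node r ok B (t ∷ ts))
          (trans (cong (_+ rest) (trans (cong (⟦ below B 0 ∧ true ⟧ *_) (countF-below0 r ok t ts))
                                        (*-zeroʳ ⟦ below B 0 ∧ true ⟧)))
                 (+-identityˡ rest))
    where
    rest : ℤ
    rest = sumBelow r (λ k → ⟦ below B (suc k) ∧ ok k ⟧ * countF r ok (just (suc k)) (t ∷ ts))

  countF-leafIndicator : ∀ r ok B →
    (∀ t → HasChildrenT t → countT r ok B t ≡ ⟦ internalT t ≡ᵇ 0 ⟧) →
    ∀ ts → HasChildrenF ts → countF r ok B ts ≡ ⟦ internalF ts ≡ᵇ 0 ⟧
  countF-leafIndicator r ok B onTrees []       _          = refl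
  countF-leafIndicator r ok B onTrees (t ∷ ts) (ht , hts) =
    trans (countF-cons r ok B t ts)
          (trans (cong₂ _*_ (onTrees t ht) (countF-leafIndicator r ok B onTrees ts hts))
                 (sym (⟦+≡ᵇ0⟧ (internalT t) (internalF ts))))

  countT-below1 : ∀ r ok t → HasChildrenT t → countT r ok (just 1) t ≡ ⟦ internalT t ≡ᵇ 0 ⟧
  countT-below1 r ok (leaf a)        _ = refl
  countT-below1 r ok (node ts) hc =
    trans (countT-node⁺ r ok (just 1) ts hc)
          (trans (sumBelow-cong r (λ k → *-zeroˡ (countF r ok (just (suc k)) ts))) (sumBelow-zero r))

  countT-level0 : ∀ ok t → HasChildrenT t → countT 0 ok nothing t ≡ ⟦ internalT t ≡ᵇ 0 ⟧
  countT-level0 ok (leaf a)        _ = refl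
  countT-level0 ok (node ts) hc = countT-node⁺ 0 ok nothing ts hc

  -- With colour 1 forbidden, lowering every colour ≥ 2 by one identifies the
  -- valid decorations with colours ≤ r+1 with those with colours ≤ r.
  mutual
    colour1-forbiddenT : ∀ r ok B t → HasChildrenT t →
      countT (suc r) (false ◂ ok) (raise (raise B)) t ≡ countT r ok (raise B) t
    colour1-forbiddenT r ok B (leaf a)        _  =
      cong (λ b → ⟦ b ⟧ + 0ℤ) (trans (below-raise-zero (raise B)) (sym (below-raise-zero B)))
    colour1-forbiddenT r ok B (node (t ∷ ts)) hc = begin
        countT (suc r) (false ◂ ok) (raise (raise B)) (node (t ∷ ts))
      ≡⟨ countT-node⁺ (suc r) (false ◂ ok) (raise (raise B)) (t ∷ ts) hc ⟩
        ⟦ below (raise (raise B)) 1 ∧ false ⟧ * countF (suc r) (false ◂ ok) (just 1) (t ∷ ts)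
          + sumBelow r (λ k → ⟦ below (raise (raise B)) (suc (suc k)) ∧ ok k ⟧
                              * countF (suc r) (false ◂ ok) (raise (raise (just k))) (t ∷ ts))
      ≡⟨ cong₂ _+_ colour1-term
                   (sumBelow-cong r (λ k → lowered k (colour1-forbiddenF r ok (just k) (t ∷ ts) hc))) ⟩
        0ℤ + sumBelow r (λ k → ⟦ below (raise B) (suc k) ∧ ok k ⟧ * countF r ok (raise (just k)) (t ∷ ts))
      ≡⟨ trans (+-identityˡ _) (sym (countT-node⁺ r ok (raise B) (t ∷ ts) hc)) ⟩
        countT r ok (raise B) (node (t ∷ ts))
      ∎
      where
      open ≡-Reasoning
      colour1-term : ⟦ below (raise (raise B)) 1 ∧ false ⟧ * countF (suc r) (false ◂ ok) (just 1) (t ∷ ts) ≡ 0ℤ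
      colour1-term = trans (cong (λ b → ⟦ b ⟧ * countF (suc r) (false ◂ ok) (just 1) (t ∷ ts))
                                 (∧-zeroʳ (below (raise (raise B)) 1)))
                           (*-zeroˡ (countF (suc r) (false ◂ ok) (just 1) (t ∷ ts)))
      lowered : ∀ k → countF (suc r) (false ◂ ok) (raise (raise (just k))) (t ∷ ts)
                        ≡ countF r ok (raise (just k)) (t ∷ ts) →
                      ⟦ below (raise (raise B)) (suc (suc k)) ∧ ok k ⟧
                        * countF (suc r) (false ◂ ok) (raise (raise (just k))) (t ∷ ts)
                      ≡ ⟦ below (raise B) (suc k) ∧ ok k ⟧ * countF r ok (raise (just k)) (t ∷ ts)
      lowered k ih = cong₂ (λ b n → ⟦ b ∧ ok k ⟧ * n) (below-raise-suc (raise B) (suc k)) ih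

    colour1-forbiddenF : ∀ r ok B ts → HasChildrenF ts →
      countF (suc r) (false ◂ ok) (raise (raise B)) ts ≡ countF r ok (raise B) ts
    colour1-forbiddenF r ok B []       _          = refl
    colour1-forbiddenF r ok B (t ∷ ts) (ht , hts) =
      trans (countF-cons (suc r) (false ◂ ok) (raise (raise B)) t ts)
            (trans (cong₂ _*_ (colour1-forbiddenT r ok B t ht) (colour1-forbiddenF r ok B ts hts))
                   (sym (countF-cons r ok (raise B) t ts)))

  -- the number of gap-free decreasing decorations with colours 0,…,r,
  -- obtained by inclusion–exclusion over the admissible colours
  gapFreeCount : ℕ → Forest m → ℤ
  gapFreeCount r F = altSum r (λ ok → countF r ok nothing F)

  gapFreeCount-zero : ∀ F → HasChildrenF F → gapFreeCount 0 F ≡ ⟦ internalF F ≡ᵇ 0 ⟧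
  gapFreeCount-zero = countF-leafIndicator 0 (λ _ → true) nothing (countT-level0 (λ _ → true))

-- Collapsing cherries, and the alternating-sum identity for gap-free counts.

module _ {m : ℕ} (dummy : Fin m) where

  -- A cherry is an internal vertex all of whose children are leaves.
  -- Collapsing it replaces it by a leaf (labelled dummy: labels play no role
  -- in counting).  properCollapsesT t lists the trees obtained from t by
  -- collapsing a nonempty set of cherries.
  mutual
    properCollapsesT : Tree m → List (Tree m)
    properCollapsesT (leaf a)  = []
    properCollapsesT (node ts) = collapseNode (internalF ts) ts

    -- the first argument is the number of internal vertices of ts,
    -- so node ts is a cherry iff it is 0
    collapseNode : ℕ → Forest m → List (Tree m)
    collapseNode zero    ts = leaf dummy ∷ []
    collapseNode (suc _) ts = map node (properCollapsesF ts)

    properCollapsesF : Forest m → List (Forest m)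
    properCollapsesF []       = []
    properCollapsesF (t ∷ ts) =
      map (t ∷_) (properCollapsesF ts) ++ consAll (properCollapsesT t) (ts ∷ properCollapsesF ts)

  -- collapses of an arbitrary set of cherries; note that
  -- collapsesF (t ∷ ts) = consAll (collapsesT t) (collapsesF ts) by definition
  collapsesT : Tree m → List (Tree m)
  collapsesT t = t ∷ properCollapsesT t

  collapsesF : Forest m → List (Forest m)
  collapsesF ts = ts ∷ properCollapsesF ts

  properCollapsesF-leaves : ∀ ts → internalF ts ≡ 0 → properCollapsesF ts ≡ []
  properCollapsesF-leaves []            _ = refl
  properCollapsesF-leaves (leaf a ∷ ts) e rewrite properCollapsesF-leaves ts e = refl
  properCollapsesF-leaves (node _ ∷ ts) ()

  mutual
    properCollapsesT-smaller : ∀ t → All (λ t′ → internalT t′ < internalT t) (properCollapsesT t)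
    properCollapsesT-smaller (leaf a)  = []
    properCollapsesT-smaller (node ts) = collapseNode-smaller ts (internalF ts) refl

    collapseNode-smaller : ∀ ts n → internalF ts ≡ n →
      All (λ t′ → internalT t′ < suc (internalF ts)) (collapseNode n ts)
    collapseNode-smaller ts zero    _ = s≤s z≤n ∷ []
    collapseNode-smaller ts (suc _) _ = map⁺ (All.map s≤s (properCollapsesF-smaller ts))

    properCollapsesF-smaller : ∀ ts → All (λ ts′ → internalF ts′ < internalF ts) (properCollapsesF ts)
    properCollapsesF-smaller []       = []
    properCollapsesF-smaller (t ∷ ts) =
      ++⁺ (map⁺ (All.map (+-monoʳ-< (internalT t)) (properCollapsesF-smaller ts)))
          (concat⁺ (map⁺ (All.map (λ lt → map⁺ (All.map (+-mono-<-≤ lt) (≤-refl ∷ All.map <⇒≤ (properCollapsesF-smaller ts))))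
                                  (properCollapsesT-smaller t))))

  mutual
    properCollapsesT-hasChildren : ∀ t → HasChildrenT t → All HasChildrenT (properCollapsesT t)
    properCollapsesT-hasChildren (leaf a)        _  = []
    properCollapsesT-hasChildren (node (t ∷ ts)) hc = collapseNode-hasChildren t ts hc (internalF (t ∷ ts))

    collapseNode-hasChildren : ∀ t ts → HasChildrenF (t ∷ ts) → ∀ n → All HasChildrenT (collapseNode n (t ∷ ts))
    collapseNode-hasChildren t ts hc zero    = tt ∷ []
    collapseNode-hasChildren t ts hc (suc _) = map⁺ (properCollapses-nodeHasChildren t ts hc)

    properCollapses-nodeHasChildren : ∀ t ts → HasChildrenF (t ∷ ts) →
      All (λ ts′ → HasChildrenT (node ts′)) (properCollapsesF (t ∷ ts))
    properCollapses-nodeHasChildren t ts (ht , hts) =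
      ++⁺ (map⁺ (All.map (ht ,_) (properCollapsesF-hasChildren ts hts)))
          (concat⁺ (map⁺ (All.map (λ ht′ → map⁺ (All.map (ht′ ,_) (hts ∷ properCollapsesF-hasChildren ts hts)))
                                  (properCollapsesT-hasChildren t ht))))

    properCollapsesF-hasChildren : ∀ ts → HasChildrenF ts → All HasChildrenF (properCollapsesF ts)
    properCollapsesF-hasChildren []       _  = []
    properCollapsesF-hasChildren (t ∷ ts) hc =
      All.map (hasChildren-children _) (properCollapses-nodeHasChildren t ts hc)

  collapses-nodeHasChildren : ∀ t ts → HasChildrenF (t ∷ ts) →
    All (λ ts′ → HasChildrenT (node ts′)) (collapsesF (t ∷ ts))
  collapses-nodeHasChildren t ts hc = hc ∷ properCollapses-nodeHasChildren t ts hc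

  mutual
    collapses-signT : ∀ t → ∑ (λ t′ → sign (internalT t′)) (collapsesT t) ≡ ⟦ internalT t ≡ᵇ 0 ⟧
    collapses-signT (leaf a)  = refl
    collapses-signT (node ts) = collapseNode-sign ts (internalF ts) refl (collapses-signF ts)

    collapseNode-sign : ∀ ts n → internalF ts ≡ n →
      ∑ (λ ts′ → sign (internalF ts′)) (collapsesF ts) ≡ ⟦ internalF ts ≡ᵇ 0 ⟧ →
      sign (suc (internalF ts)) + ∑ (λ t′ → sign (internalT t′)) (collapseNode n ts) ≡ 0ℤ
    collapseNode-sign ts zero    w≡0 _  rewrite w≡0 = refl
    collapseNode-sign ts (suc n) w≡n ih = begin
        sign (suc w) + ∑ (λ t′ → sign (internalT t′)) (map node (properCollapsesF ts))
      ≡⟨ cong (sign (suc w) +_) (∑-map (λ t′ → sign (internalT t′)) node (properCollapsesF ts)) ⟩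
        ∑ (λ ts′ → -1ℤ * sign (internalF ts′)) (collapsesF ts)
      ≡⟨ ∑-scaleˡ -1ℤ (λ ts′ → sign (internalF ts′)) (collapsesF ts) ⟩
        -1ℤ * ∑ (λ ts′ → sign (internalF ts′)) (collapsesF ts)
      ≡⟨ cong (-1ℤ *_) (trans ih (cong (λ k → ⟦ k ≡ᵇ 0 ⟧) w≡n)) ⟩
        0ℤ
      ∎
      where
      open ≡-Reasoning
      w : ℕ
      w = internalF ts

    collapses-signF : ∀ ts → ∑ (λ ts′ → sign (internalF ts′)) (collapsesF ts) ≡ ⟦ internalF ts ≡ᵇ 0 ⟧
    collapses-signF []       = refl
    collapses-signF (t ∷ ts) =
      trans (∑-consAll (λ ts′ → sign (internalF ts′)) (λ t′ → sign (internalT t′)) (λ ts′ → sign (internalF ts′))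
                       (λ t′ ts′ → ^-distribˡ-+-* -1ℤ (internalT t′) (internalF ts′)) (collapsesT t) (collapsesF ts))
            (trans (cong₂ _*_ (collapses-signT t) (collapses-signF ts)) (sym (⟦+≡ᵇ0⟧ (internalT t) (internalF ts))))

  -- With colour 1 admissible, the vertices of colour 1 are cherries (their
  -- children have colour 0).  Collapsing them and lowering all other colours
  -- by one identifies the valid decorations with colours ≤ r+1 with the valid
  -- decorations with colours ≤ r of all the collapses.
  colour1-allowedNode : ∀ r ok B t ts → HasChildrenF (t ∷ ts) → ∀ n → internalF (t ∷ ts) ≡ n →
    (∀ k → countF (suc r) (true ◂ ok) (raise (raise (just k))) (t ∷ ts)
             ≡ ∑ (countF r ok (raise (just k))) (collapsesF (t ∷ ts))) →
    countT (suc r) (true ◂ ok) (raise (raise B)) (node (t ∷ ts))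
      ≡ countT r ok (raise B) (node (t ∷ ts)) + ∑ (countT r ok (raise B)) (collapseNode n (t ∷ ts))
  colour1-allowedNode r ok B t ts hc n w≡n ih = trans lowered (cherry-or-not n w≡n)
    where
    open ≡-Reasoning
    ts₀ : Forest m
    ts₀ = t ∷ ts
    term : Forest m → ℕ → ℤ
    term ts′ k = ⟦ below (raise B) (suc k) ∧ ok k ⟧ * countF r ok (just (suc k)) ts′
    X : ℤ
    X = ∑ (λ ts′ → sumBelow r (term ts′)) (collapsesF ts₀)
    -- colour 1 contributes the cherry indicator, higher colours are lowered
    lowered : countT (suc r) (true ◂ ok) (raise (raise B)) (node ts₀) ≡ ⟦ internalF ts₀ ≡ᵇ 0 ⟧ + X
    lowered = begin
        countT (suc r) (true ◂ ok) (raise (raise B)) (node ts₀)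
      ≡⟨ countT-node⁺ (suc r) (true ◂ ok) (raise (raise B)) ts₀ hc ⟩
        ⟦ below (raise (raise B)) 1 ∧ true ⟧ * countF (suc r) (true ◂ ok) (just 1) ts₀
          + sumBelow r (λ k → ⟦ below (raise (raise B)) (suc (suc k)) ∧ ok k ⟧
                              * countF (suc r) (true ◂ ok) (raise (raise (just k))) ts₀)
      ≡⟨ cong₂ _+_ colour1-term (sumBelow-cong r (λ k → cong₂ (λ b c → ⟦ b ∧ ok k ⟧ * c)
                                                           (below-raise-suc (raise B) (suc k)) (ih k))) ⟩
        ⟦ internalF ts₀ ≡ᵇ 0 ⟧ + sumBelow r (λ k → ⟦ below (raise B) (suc k) ∧ ok k ⟧
                                                     * ∑ (countF r ok (just (suc k))) (collapsesF ts₀))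
      ≡⟨ cong (⟦ internalF ts₀ ≡ᵇ 0 ⟧ +_)
              (trans (sumBelow-cong r (λ k → sym (∑-scaleˡ ⟦ below (raise B) (suc k) ∧ ok k ⟧
                                                            (countF r ok (just (suc k))) (collapsesF ts₀))))
                     (sumBelow-∑ r term (collapsesF ts₀))) ⟩
        ⟦ internalF ts₀ ≡ᵇ 0 ⟧ + X
      ∎
      where
      colour1-term : ⟦ below (raise (raise B)) 1 ∧ true ⟧ * countF (suc r) (true ◂ ok) (just 1) ts₀
                     ≡ ⟦ internalF ts₀ ≡ᵇ 0 ⟧
      colour1-term rewrite below-raise-suc (raise B) 0 | below-raise-zero B =
        trans (*-identityˡ _) (countF-leafIndicator (suc r) (true ◂ ok) (just 1) (countT-below1 (suc r) (true ◂ ok)) ts₀ hc)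
    cherry-or-not : ∀ n → internalF ts₀ ≡ n →
      ⟦ internalF ts₀ ≡ᵇ 0 ⟧ + X ≡ countT r ok (raise B) (node ts₀) + ∑ (countT r ok (raise B)) (collapseNode n ts₀)
    cherry-or-not zero w≡0
      rewrite w≡0 | properCollapsesF-leaves ts₀ w≡0 | countT-node⁺ r ok (raise B) ts₀ hc | below-raise-zero B =
      swap (sumBelow r (term ts₀))
      where
      swap : ∀ x → 1ℤ + (x + 0ℤ) ≡ x + 1ℤ
      swap = solve-∀
    cherry-or-not (suc _) w≡n rewrite w≡n = begin
        0ℤ + X
      ≡⟨ +-identityˡ X ⟩
        X
      ≡⟨ sym (∑-cong (All.map (countT-node⁺ r ok (raise B) _) (collapses-nodeHasChildren t ts hc))) ⟩
        ∑ (λ ts′ → countT r ok (raise B) (node ts′)) (collapsesF ts₀)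
      ≡⟨ cong (countT r ok (raise B) (node ts₀) +_) (sym (∑-map (countT r ok (raise B)) node (properCollapsesF ts₀))) ⟩
        countT r ok (raise B) (node ts₀) + ∑ (countT r ok (raise B)) (map node (properCollapsesF ts₀))
      ∎

  mutual
    colour1-allowedT : ∀ r ok B t → HasChildrenT t →
      countT (suc r) (true ◂ ok) (raise (raise B)) t ≡ ∑ (countT r ok (raise B)) (collapsesT t)
    colour1-allowedT r ok B (leaf a) _ rewrite below-raise-zero (raise B) | below-raise-zero B = refl
    colour1-allowedT r ok B (node (t ∷ ts)) hc =
      colour1-allowedNode r ok B t ts hc (internalF (t ∷ ts)) refl (λ k → colour1-allowedF r ok (just k) (t ∷ ts) hc)

    colour1-allowedF : ∀ r ok B ts → HasChildrenF ts →
      countF (suc r) (true ◂ ok) (raise (raise B)) ts ≡ ∑ (countF r ok (raise B)) (collapsesF ts)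
    colour1-allowedF r ok B []       _          = refl
    colour1-allowedF r ok B (t ∷ ts) (ht , hts) =
      trans (countF-cons (suc r) (true ◂ ok) (raise (raise B)) t ts)
            (trans (cong₂ _*_ (colour1-allowedT r ok B t ht) (colour1-allowedF r ok B ts hts))
                   (sym (∑-consAll (countF r ok (raise B)) (countT r ok (raise B)) (countF r ok (raise B))
                                   (countF-cons r ok (raise B)) (collapsesT t) (collapsesF ts))))

  -- Gap-free colourings of length r+1 of F correspond to gap-free colourings
  -- of length r of the proper collapses of F (collapse the colour-1 vertices).
  gapFreeCount-suc : ∀ r F → HasChildrenF F → gapFreeCount (suc r) F ≡ ∑ (gapFreeCount r) (properCollapsesF F)
  gapFreeCount-suc r F hc = begin
      altSum r (λ ok → countF (suc r) (true ◂ ok) nothing F) - altSum r (λ ok → countF (suc r) (false ◂ ok) nothing F)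
    ≡⟨ cong₂ _-_ (altSum-cong r (λ ok → colour1-allowedF r ok nothing F hc))
                 (altSum-cong r (λ ok → colour1-forbiddenF r ok nothing F hc)) ⟩
      altSum r (λ ok → ∑ (countF r ok nothing) (collapsesF F)) - gapFreeCount r F
    ≡⟨ cong (_- gapFreeCount r F) (altSum-∑ r (λ F′ ok → countF r ok nothing F′) (collapsesF F)) ⟩
      (gapFreeCount r F + ∑ (gapFreeCount r) (properCollapsesF F)) - gapFreeCount r F
    ≡⟨ cancel (gapFreeCount r F) (∑ (gapFreeCount r) (properCollapsesF F)) ⟩
      ∑ (gapFreeCount r) (properCollapsesF F)
    ∎
    where
    open ≡-Reasoning
    cancel : ∀ a b → (a + b) - a ≡ b
    cancel = solve-∀

  alternating-gapFree : ∀ K F → HasChildrenF F → internalF F ≤ K →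
    sumBelow (suc K) (λ r → sign r * gapFreeCount r F) ≡ sign (internalF F)
  alternating-gapFree zero    F hc w≤0
    rewrite gapFreeCount-zero F hc | n≤0⇒n≡0 w≤0 = refl
  alternating-gapFree (suc K) F hc w≤K = begin
      sign 0 * gapFreeCount 0 F + sumBelow (suc K) (λ r → sign (suc r) * gapFreeCount (suc r) F)
    ≡⟨ cong₂ _+_ (trans (*-identityˡ (gapFreeCount 0 F)) (gapFreeCount-zero F hc))
                 (sumBelow-cong (suc K) (λ r → step r)) ⟩
      ⟦ w ≡ᵇ 0 ⟧ + sumBelow (suc K) (λ r → -1ℤ * ∑ (λ F′ → sign r * gapFreeCount r F′) collapses)
    ≡⟨ cong (⟦ w ≡ᵇ 0 ⟧ +_)
            (trans (sumBelow-scale (suc K) -1ℤ (λ r → ∑ (λ F′ → sign r * gapFreeCount r F′) collapses))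
                   (cong (-1ℤ *_) (sumBelow-∑ (suc K) (λ F′ r → sign r * gapFreeCount r F′) collapses))) ⟩
      ⟦ w ≡ᵇ 0 ⟧ + -1ℤ * ∑ (λ F′ → sumBelow (suc K) (λ r → sign r * gapFreeCount r F′)) collapses
    ≡⟨ cong (λ x → ⟦ w ≡ᵇ 0 ⟧ + -1ℤ * x)
            (∑-cong (All.zipWith induction (properCollapsesF-hasChildren F hc , properCollapsesF-smaller F))) ⟩
      ⟦ w ≡ᵇ 0 ⟧ + -1ℤ * ∑ (λ F′ → sign (internalF F′)) collapses
    ≡⟨ cong (_+ -1ℤ * ∑ (λ F′ → sign (internalF F′)) collapses) (sym (collapses-signF F)) ⟩
      (sign w + ∑ (λ F′ → sign (internalF F′)) collapses) + -1ℤ * ∑ (λ F′ → sign (internalF F′)) collapses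
    ≡⟨ cancel (sign w) (∑ (λ F′ → sign (internalF F′)) collapses) ⟩
      sign w
    ∎
    where
    open ≡-Reasoning
    w : ℕ
    w = internalF F
    collapses : List (Forest m)
    collapses = properCollapsesF F
    step : ∀ r → sign (suc r) * gapFreeCount (suc r) F ≡ -1ℤ * ∑ (λ F′ → sign r * gapFreeCount r F′) collapses
    step r = trans (cong (sign (suc r) *_) (gapFreeCount-suc r F hc))
                   (trans (*-assoc -1ℤ (sign r) _) (cong (-1ℤ *_) (sym (∑-scaleˡ (sign r) (gapFreeCount r) collapses))))
    induction : ∀ {F′} → HasChildrenF F′ × internalF F′ < w →
                sumBelow (suc K) (λ r → sign r * gapFreeCount r F′) ≡ sign (internalF F′)
    induction {F′} (hc′ , smaller) = alternating-gapFree K F′ hc′ (≤-pred (≤-trans smaller w≤K))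
    cancel : ∀ s x → (s + x) + -1ℤ * x ≡ s
    cancel = solve-∀

-- From the colouring sum to gap-free counts: for a reduced mixing forest the
-- colourings of length r are exactly the gap-free decreasing decorations.

if-indicator : ∀ b (s : ℤ) → (if b then s else 0ℤ) ≡ s * ⟦ b ⟧
if-indicator true  s = sym (*-identityʳ s)
if-indicator false s = sym (*-zeroʳ s)

∧-split : ∀ {a b} → a ∧ b ≡ true → a ≡ true × b ≡ true
∧-split {true} {true} _ = refl , refl

∨-split : ∀ {a b} → a ∨ b ≡ true → a ≡ true ⊎ b ≡ true
∨-split {true}  _ = inj₁ refl
∨-split {false} e = inj₂ e

any-++ : {A : Set} (p : A → Bool) (xs ys : List A) → any p (xs ++ ys) ≡ any p xs ∨ any p ys
any-++ p []       ys = refl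
any-++ p (x ∷ xs) ys = trans (cong (p x ∨_) (any-++ p xs ys)) (sym (∨-assoc (p x) _ _))

any-∈ : {A : Set} (p : A → Bool) {x : A} {xs : List A} → x ∈ xs → p x ≡ true → any p xs ≡ true
any-∈ p (here refl) px rewrite px = refl
any-∈ p {xs = y ∷ ys} (there x∈ys) px = trans (cong (p y ∨_) (any-∈ p x∈ys px)) (∨-zeroʳ (p y))

colouring-bool : ∀ d z a w → (d ≡ true → z ≡ true) → (d ≡ true → w ≡ true) → d ∧ ((z ∧ a) ∧ w) ≡ d ∧ a
colouring-bool false z a w _  _  = refl
colouring-bool true  z a w z≡ w≡ rewrite z≡ refl | w≡ refl = ∧-identityʳ a

module _ {m : ℕ} where

  mutual
    eraseT : CTree m → Tree m
    eraseT (cleaf a)    = leaf a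
    eraseT (cnode c ds) = node (eraseF ds)

    eraseF : CForest m → Forest m
    eraseF []       = []
    eraseF (d ∷ ds) = eraseT d ∷ eraseF ds

  mutual
    decorationsT-erase : ∀ r (t : Tree m) → All (λ d → eraseT d ≡ t) (decorationsT r t)
    decorationsT-erase r (leaf a)  = refl ∷ []
    decorationsT-erase r (node ts) =
      concat⁺ (map⁺ (All.universal (λ c → map⁺ (All.map (cong node) (decorationsF-erase r ts))) (upTo (suc r))))

    decorationsF-erase : ∀ r (ts : Forest m) → All (λ G → eraseF G ≡ ts) (decorationsF r ts)
    decorationsF-erase r []       = refl ∷ []
    decorationsF-erase r (t ∷ ts) =
      concat⁺ (map⁺ (All.map (λ d↦t → map⁺ (All.map (cong₂ _∷_ d↦t) (decorationsF-erase r ts)))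
                             (decorationsT-erase r t)))

  mutual
    reduced⇒hasChildrenT : ∀ (t : Tree m) → ReducedT t → HasChildrenT t
    reduced⇒hasChildrenT (leaf a)        _             = tt
    reduced⇒hasChildrenT (node [])       (() , _)
    reduced⇒hasChildrenT (node (t ∷ ts)) (_ , rt , rts) = reduced⇒hasChildrenT t rt , reduced⇒hasChildrenF ts rts

    reduced⇒hasChildrenF : ∀ (ts : Forest m) → ReducedF ts → HasChildrenF ts
    reduced⇒hasChildrenF []       _          = tt
    reduced⇒hasChildrenF (t ∷ ts) (rt , rts) = reduced⇒hasChildrenT t rt , reduced⇒hasChildrenF ts rts

  -- leaves are coloured 0, so colour 0 occurs as soon as there is a leaf
  mutual
    leaf-colour0T : ∀ {a} (d : CTree m) → a ∈ leavesT (eraseT d) → occurs 0 (coloursT d) ≡ true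
    leaf-colour0T (cleaf b)    _   = refl
    leaf-colour0T (cnode c ds) a∈d = trans (cong ((0 ≡ᵇ c) ∨_) (leaf-colour0F ds a∈d)) (∨-zeroʳ (0 ≡ᵇ c))

    leaf-colour0F : ∀ {a} (ds : CForest m) → a ∈ leavesF (eraseF ds) → occurs 0 (coloursF ds) ≡ true
    leaf-colour0F (d ∷ ds) a∈ds with ∈-++⁻ (leavesT (eraseT d)) a∈ds
    ... | inj₁ a∈d  = trans (any-++ (0 ≡ᵇ_) (coloursT d) (coloursF ds))
                            (cong (_∨ occurs 0 (coloursF ds)) (leaf-colour0T d a∈d))
    ... | inj₂ a∈ds′ = trans (any-++ (0 ≡ᵇ_) (coloursT d) (coloursF ds))
                             (trans (cong (occurs 0 (coloursT d) ∨_) (leaf-colour0F ds a∈ds′))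
                                    (∨-zeroʳ (occurs 0 (coloursT d))))

  -- in a decreasing decoration the children of a colour-1 vertex have colour 0,
  -- hence are leaves (internal vertices have children)
  colour0-children-leaves : ∀ (ds : CForest m) → all (λ t → colour t <ᵇ 1) ds ≡ true →
    decreasingF ds ≡ true → HasChildrenF (eraseF ds) → All IsLeaf (eraseF ds)
  colour0-children-leaves []                        _   _   _          = []
  colour0-children-leaves (cleaf a ∷ ds)            <1  dec (_ , hcds) =
    (a , refl) ∷ colour0-children-leaves ds <1 dec hcds
  colour0-children-leaves (cnode zero [] ∷ ds)      _   _   (() , _)
  colour0-children-leaves (cnode zero (_ ∷ _) ∷ ds) _   ()  _
  colour0-children-leaves (cnode (suc c) _ ∷ ds)    ()  _   _

  leaf-label : ∀ {a} (ds : CForest m) → leaf a ∈ eraseF ds → a ∈ leafLabels ds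
  leaf-label (cleaf b ∷ ds)    (here refl) = here refl
  leaf-label (cleaf b ∷ ds)    (there a∈)  = there (leaf-label ds a∈)
  leaf-label (cnode c _ ∷ ds)  (there a∈)  = leaf-label ds a∈

  module _ {n : ℕ} (block : Fin m → Fin n) where

    mixed-from-witness : ∀ (ds : CForest m) →
      (∃₂ λ a b → leaf a ∈ eraseF ds × leaf b ∈ eraseF ds × block a ≢ block b) → mixedChildren block ds ≡ true
    mixed-from-witness ds (a , b , a∈ , b∈ , a≁b) =
      any-∈ (λ a′ → any (λ b′ → not ⌊ block a′ Fin.≟ block b′ ⌋) (leafLabels ds)) (leaf-label ds a∈)
            (any-∈ (λ b′ → not ⌊ block a Fin.≟ block b′ ⌋) (leaf-label ds b∈) (distinct a≁b))
      where
      distinct : block a ≢ block b → not ⌊ block a Fin.≟ block b ⌋ ≡ true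
      distinct a≁b with block a Fin.≟ block b
      ... | yes a∼b = ⊥-elim (a≁b a∼b)
      ... | no  _   = refl

    mutual
      colour1-mixedT : ∀ (d : CTree m) → decreasingT d ≡ true → MixingT block (eraseT d) →
        HasChildrenT (eraseT d) → occurs 1 (coloursT d) ≡ true → any (mixedChildren block) (colour1ChildrenT d) ≡ true
      colour1-mixedT (cleaf a)                  _   _             _  ()
      colour1-mixedT (cnode zero ds)            dec (_ , mixds)   hc used1 =
        colour1-mixedF ds (proj₂ (∧-split {all (λ t → colour t <ᵇ 0) ds} dec)) mixds (hasChildren-children (eraseF ds) hc) used1
      colour1-mixedT (cnode (suc zero) ds)      dec (mixing , _)  hc _     =
        cong (_∨ any (mixedChildren block) (colour1ChildrenF ds))
             (mixed-from-witness ds (mixing (colour0-children-leaves ds (proj₁ split) (proj₂ split)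
                                                                     (hasChildren-children (eraseF ds) hc))))
        where
        split : (all (λ t → colour t <ᵇ 1) ds ≡ true) × (decreasingF ds ≡ true)
        split = ∧-split {all (λ t → colour t <ᵇ 1) ds} dec
      colour1-mixedT (cnode (suc (suc c)) ds)   dec (_ , mixds)   hc used1 =
        colour1-mixedF ds (proj₂ (∧-split {all (λ t → colour t <ᵇ suc (suc c)) ds} dec)) mixds
                       (hasChildren-children (eraseF ds) hc) used1

      colour1-mixedF : ∀ (ds : CForest m) → decreasingF ds ≡ true → MixingF block (eraseF ds) →
        HasChildrenF (eraseF ds) → occurs 1 (coloursF ds) ≡ true → any (mixedChildren block) (colour1ChildrenF ds) ≡ true
      colour1-mixedF []       _   _              _           ()
      colour1-mixedF (d ∷ ds) dec (mixd , mixds) (hcd , hcds) used1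
        with ∨-split (trans (sym (any-++ (1 ≡ᵇ_) (coloursT d) (coloursF ds))) used1)
      ... | inj₁ used1d  =
        trans (any-++ (mixedChildren block) (colour1ChildrenT d) (colour1ChildrenF ds))
              (cong (_∨ any (mixedChildren block) (colour1ChildrenF ds))
                    (colour1-mixedT d (proj₁ (∧-split {decreasingT d} dec)) mixd hcd used1d))
      ... | inj₂ used1ds =
        trans (any-++ (mixedChildren block) (colour1ChildrenT d) (colour1ChildrenF ds))
              (trans (cong (any (mixedChildren block) (colour1ChildrenT d) ∨_)
                           (colour1-mixedF ds (proj₂ (∧-split {decreasingT d} dec)) mixds hcds used1ds))
                     (∨-zeroʳ (any (mixedChildren block) (colour1ChildrenT d))))

    weaklyMixing : ∀ (G : CForest m) → decreasingF G ≡ true → MixingF block (eraseF G) → HasChildrenF (eraseF G) →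
      any (mixedChildren block) (colour1ChildrenF G) ∨ not (occurs 1 (coloursF G)) ≡ true
    weaklyMixing G dec mix hc with occurs 1 (coloursF G) in used1
    ... | true  rewrite colour1-mixedF G dec mix hc used1 = refl
    ... | false = ∨-zeroʳ (any (mixedChildren block) (colour1ChildrenF G))

    colouring-criterion : ∀ r (G : CForest m) → (∃ λ a → a ∈ leavesF (eraseF G)) →
      MixingF block (eraseF G) → HasChildrenF (eraseF G) →
      isColouring block r G ≡ decreasingF G ∧ everyBelow r (λ k → occurs (suc k) (coloursF G))
    colouring-criterion r G (a , a∈G) mix hc =
      trans (colouring-bool (decreasingF G) (occurs 0 (coloursF G)) _ _
                            (λ _ → leaf-colour0F G a∈G) (λ dec → weaklyMixing G dec mix hc))
            (cong (decreasingF G ∧_) (all-applyUpTo (λ j → occurs j (coloursF G)) suc r))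

  gapFree-indicator : ∀ r (G : CForest m) →
    ⟦ decreasingF G ∧ everyBelow r (λ k → occurs (suc k) (coloursF G)) ⟧ ≡ altSum r (λ ok → ⟦ validF ok nothing G ⟧)
  gapFree-indicator r G = begin
      ⟦ decreasingF G ∧ everyBelow r (λ k → occurs (suc k) (coloursF G)) ⟧
    ≡⟨ ⟦∧⟧ (decreasingF G) _ ⟩
      ⟦ decreasingF G ⟧ * ⟦ everyBelow r (λ k → occurs (suc k) (coloursF G)) ⟧
    ≡⟨ cong (⟦ decreasingF G ⟧ *_) (sym (inclusion–exclusion r (coloursF G))) ⟩
      ⟦ decreasingF G ⟧ * altSum r (λ ok → ⟦ all (admissible ok) (coloursF G) ⟧)
    ≡⟨ sym (altSum-scale r ⟦ decreasingF G ⟧ (λ ok → ⟦ all (admissible ok) (coloursF G) ⟧)) ⟩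
      altSum r (λ ok → ⟦ decreasingF G ⟧ * ⟦ all (admissible ok) (coloursF G) ⟧)
    ≡⟨ altSum-cong r (λ ok → trans (sym (⟦∧⟧ (decreasingF G) (all (admissible ok) (coloursF G))))
                                   (cong ⟦_⟧ (sym (validF-unbounded ok G)))) ⟩
      altSum r (λ ok → ⟦ validF ok nothing G ⟧)
    ∎
    where open ≡-Reasoning

  module _ {n : ℕ} (block : Fin m → Fin n) where

    decoration-term : ∀ r F (G : CForest m) → eraseF G ≡ F → (∃ λ a → a ∈ leavesF F) →
      MixingF block F → HasChildrenF F →
      (if isColouring block r G then sign r else 0ℤ) ≡ sign r * altSum r (λ ok → ⟦ validF ok nothing G ⟧)
    decoration-term r .(eraseF G) G refl hasLeaf mix hc =
      trans (if-indicator (isColouring block r G) (sign r))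
            (cong (sign r *_) (trans (cong ⟦_⟧ (colouring-criterion block r G hasLeaf mix hc)) (gapFree-indicator r G)))

    colouringSum-at : ∀ r F → (∃ λ a → a ∈ leavesF F) → MixingF block F → HasChildrenF F →
      ∑ (λ G → if isColouring block r G then sign r else 0ℤ) (decorationsF r F) ≡ sign r * gapFreeCount r F
    colouringSum-at r F hasLeaf mix hc = begin
        ∑ (λ G → if isColouring block r G then sign r else 0ℤ) (decorationsF r F)
      ≡⟨ ∑-cong (All.map (λ {G} G↦F → decoration-term r F G G↦F hasLeaf mix hc) (decorationsF-erase r F)) ⟩
        ∑ (λ G → sign r * altSum r (λ ok → ⟦ validF ok nothing G ⟧)) (decorationsF r F)
      ≡⟨ ∑-scaleˡ (sign r) (λ G → altSum r (λ ok → ⟦ validF ok nothing G ⟧)) (decorationsF r F) ⟩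
        sign r * ∑ (λ G → altSum r (λ ok → ⟦ validF ok nothing G ⟧)) (decorationsF r F)
      ≡⟨ cong (sign r *_) (sym (altSum-∑ r (λ G ok → ⟦ validF ok nothing G ⟧) (decorationsF r F))) ⟩
        sign r * gapFreeCount r F
      ∎
      where open ≡-Reasoning

  some-leaf : ∀ (F : Forest m) → 1 ≤ m → leavesF F ↭ allFin m → ∃ λ a → a ∈ leavesF F
  some-leaf F (s≤s z≤n) leaves↭ = Fin.zero , ∈-resp-↭ (↭-sym leaves↭) (∈-allFin Fin.zero)

lemma3p5 : (n m : ℕ) (block : Fin m → Fin n) (F : Forest m)
         → 1 ≤ m
         → leavesF F ↭ allFin m
         → ReducedF F
         → MixingF block F
         → colouringSum block F ≡ sign (internalF F)
lemma3p5 n m block F 1≤m leaves↭ reduced mixing = begin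
    colouringSum block F
  ≡⟨ ∑-applyUpTo colouringsOfLength (λ r → r) (suc w) ⟩
    sumBelow (suc w) colouringsOfLength
  ≡⟨ sumBelow-cong (suc w) (λ r → colouringSum-at block r F hasLeaf mixing hc) ⟩
    sumBelow (suc w) (λ r → sign r * gapFreeCount r F)
  ≡⟨ alternating-gapFree (proj₁ hasLeaf) w F hc ≤-refl ⟩
    sign w
  ∎
  where
  open ≡-Reasoning
  w : ℕ
  w = internalF F
  hc : HasChildrenF F
  hc = reduced⇒hasChildrenF F reduced
  hasLeaf : ∃ λ a → a ∈ leavesF F
  hasLeaf = some-leaf F 1≤m leaves↭
  colouringsOfLength : ℕ → ℤ
  colouringsOfLength r = ∑ (λ G → if isColouring block r G then sign r else 0ℤ) (decorationsF r F)
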